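{- For $n \geq 3$, the number of $i$-sets of the cycle $C_n$ (the order of $\mathscr{I}(C_n)$) is \[ |V(\mathscr{I}(C_n))| = \begin{cases} 3 & \text{if } n = 3k,\\ k(3k+1)/2 & \text{if } n = 3k+1,\\ n & \text{if } n = 3k+2, \end{cases} \] where $k$ is a nonnegative integer.
   Context: For a graph $G$, $i(G)$ is the minimum size of an independent dominating set, and an $i$-set of $G$ is an independent dominating set of size $i(G)$. $\mathscr{I}(G)$ denotes the $i$-graph of $G$, whose vertex set is the set of $i$-sets of $G$. $C_n$ is the cycle on $n$ vertices. -}

module Defs where

open import Data.Nat using (ℕ; zero; suc; _+_; _*_; _≤_)
open import Data.Fin using (Fin; toℕ)
open import Data.Fin.Subset using (Subset; _∈_; ∣_∣)
open import Data.List using (List; length)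
open import Data.List.Relation.Unary.Unique.Propositional using (Unique)
import Data.List.Membership.Propositional as LM
open import Data.Product using (Σ; ∃; _×_; _,_)
open import Data.Sum using (_⊎_)
open import Relation.Nullary using (¬_)
open import Relation.Binary.PropositionalEquality using (_≡_)
open import Function.Bundles using (_⇔_)

Succ : (n : ℕ) → Fin n → Fin n → Set
Succ n i j = (toℕ j ≡ suc (toℕ i)) ⊎ ((suc (toℕ i) ≡ n) × (toℕ j ≡ 0))

Adj : (n : ℕ) → Fin n → Fin n → Set
Adj n i j = Succ n i j ⊎ Succ n j i

Independent : (n : ℕ) → Subset n → Set
Independent n S = ∀ (u v : Fin n) → u ∈ S → v ∈ S → ¬ Adj n u v

Dominating : (n : ℕ) → Subset n → Set
Dominating n S = ∀ (v : Fin n) → v ∈ S ⊎ (Σ (Fin n) λ u → u ∈ S × Adj n u v)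

IndepDom : (n : ℕ) → Subset n → Set
IndepDom n S = Independent n S × Dominating n S

ISet : (n : ℕ) → Subset n → Set
ISet n S = IndepDom n S × (∀ (T : Subset n) → IndepDom n T → ∣ S ∣ ≤ ∣ T ∣)

NumISets : (n c : ℕ) → Set
NumISets n c = Σ (List (Subset n)) λ L →
  Unique L × (∀ (S : Subset n) → ISet n S ⇔ (S LM.∈ L)) × (length L ≡ c)

-- A set S of vertices of C_n is an independent dominating set iff in every window (p, c, s) of
-- three consecutive vertices, p and c are not both in S and one of p, c, s is. Reading S as a word
-- followed by its first two letters again turns this into a left-to-right scan, so the sets can be
-- counted by size with a dynamic programme. After a one, the next one comes 2 or 3 steps later;
-- hence the counts obey A(x+3, r+1) = A(x, r) + A(x+1, r) and are binomial coefficients. Splitting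
-- by the first two vertices, C_n with n = 3 + 2c + d has exactly 2·C(c+1, d+1) + C(c, d) independent
-- dominating sets of size c+1. This count vanishes when 3(c+1) < n, so i(C_n) = ⌈n/3⌉, and at that
-- size it equals 3, k(3k+1)/2 or n.

module Submission where

open import Defs
open import Data.Bool using (Bool; true; false; T; not; _∧_; _∨_; if_then_else_)
open import Data.Bool.Properties using (T-∧; T-≡; ∧-zeroʳ)
open import Data.Empty using (⊥-elim)
open import Data.Fin as Fin using (Fin; toℕ; fromℕ; fromℕ<; inject₁)
open import Data.Fin.Properties using (toℕ-injective; toℕ<n; toℕ-fromℕ; toℕ-fromℕ<; toℕ-inject₁)
open import Data.Fin.Subset using (Subset; _∈_; ∣_∣)
open import Data.Fin.Subset.Properties using (∣p∣≤∣x∷p∣)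
open import Data.List using (List; []; _∷_; map; _++_; length)
open import Data.List.Properties using (length-++; length-map)
open import Data.List.Relation.Unary.Any using (here)
open import Data.List.Relation.Unary.All using ([])
open import Data.List.Relation.Unary.AllPairs using ([]; _∷_)
open import Data.List.Relation.Unary.Unique.Propositional using (Unique)
import Data.List.Relation.Unary.Unique.Propositional.Properties as Unique
import Data.List.Membership.Propositional as List
open import Data.List.Membership.Propositional.Properties
  using (∈-map⁺; ∈-map⁻; ∈-++⁺ˡ; ∈-++⁺ʳ; ∈-++⁻)
open import Data.Nat using (ℕ; zero; suc; _+_; _*_; _∸_; _≤_; _<_; _≡ᵇ_; z≤n; s≤s; _≤?_)
open import Data.Nat.Combinatorics using (_C_; nCn≡1; k>n⇒nCk≡0; nCk+nC[k+1]≡[n+1]C[k+1])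
open import Data.Nat.DivMod using (_/_; m*n/n≡m)
open import Data.Nat.Properties
open import Data.Nat.Tactic.RingSolver using (solve-∀)
open import Data.Product using (_×_; _,_; proj₁; proj₂; ∃)
open import Data.Sum using (_⊎_; inj₁; inj₂)
open import Data.Vec using (Vec; []; _∷_; lookup; here; there) renaming (_++_ to _++ᵛ_)
open import Data.Vec.Properties using (∷-injectiveʳ; []=⇒lookup; lookup⇒[]=)
open import Function using (_∘_)
open import Function.Bundles using (mk⇔; Equivalence)
open import Relation.Binary.PropositionalEquality
open import Relation.Nullary using (¬_; yes; no)

open Equivalence using (to; from)
open ≡-Reasoning

private
  variable
    m n : ℕ

solutions : (n : ℕ) → (Vec Bool n → Bool) → List (Vec Bool n)
solutions zero    P = if P [] then [] ∷ [] else []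
solutions (suc n) P =
  map (true ∷_) (solutions n (P ∘ (true ∷_))) ++ map (false ∷_) (solutions n (P ∘ (false ∷_)))

solutions-sound : ∀ n P {v} → v List.∈ solutions n P → T (P v)
solutions-sound zero P {[]} v∈ with P []
... | true = _
solutions-sound zero P {[]} () | false
solutions-sound (suc n) P v∈ with ∈-++⁻ (map (true ∷_) (solutions n (P ∘ (true ∷_)))) v∈
... | inj₁ v∈ˡ with ∈-map⁻ (true ∷_) v∈ˡ
...   | w , w∈ , refl = solutions-sound n (P ∘ (true ∷_)) w∈
solutions-sound (suc n) P v∈ | inj₂ v∈ʳ with ∈-map⁻ (false ∷_) v∈ʳ
...   | w , w∈ , refl = solutions-sound n (P ∘ (false ∷_)) w∈

solutions-complete : ∀ n P (v : Vec Bool n) → T (P v) → v List.∈ solutions n P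
solutions-complete zero P [] Pv with P []
... | true = here refl
solutions-complete (suc n) P (true ∷ w) Pv =
  ∈-++⁺ˡ (∈-map⁺ (true ∷_) (solutions-complete n (P ∘ (true ∷_)) w Pv))
solutions-complete (suc n) P (false ∷ w) Pv =
  ∈-++⁺ʳ (map (true ∷_) (solutions n (P ∘ (true ∷_))))
         (∈-map⁺ (false ∷_) (solutions-complete n (P ∘ (false ∷_)) w Pv))

solutions-unique : ∀ n P → Unique (solutions n P)
solutions-unique zero P with P []
... | true  = [] ∷ []
... | false = []
solutions-unique (suc n) P =
  Unique.++⁺ (Unique.map⁺ ∷-injectiveʳ (solutions-unique n (P ∘ (true ∷_))))
             (Unique.map⁺ ∷-injectiveʳ (solutions-unique n (P ∘ (false ∷_))))
             disjoint
  where
  disjoint : ∀ {v} → ¬ (v List.∈ map (true ∷_) (solutions n (P ∘ (true ∷_)))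
                        × v List.∈ map (false ∷_) (solutions n (P ∘ (false ∷_))))
  disjoint (v∈ˡ , v∈ʳ) with ∈-map⁻ (true ∷_) v∈ˡ | ∈-map⁻ (false ∷_) v∈ʳ
  ... | _ , _ , refl | _ , _ , ()

#solutions : (n : ℕ) → (Vec Bool n → Bool) → ℕ
#solutions n P = length (solutions n P)

#solutions-suc : ∀ n P → #solutions (suc n) P ≡ #solutions n (P ∘ (true ∷_)) + #solutions n (P ∘ (false ∷_))
#solutions-suc n P =
  trans (length-++ (map (true ∷_) L₁)) (cong₂ _+_ (length-map (true ∷_) L₁) (length-map (false ∷_) L₀))
  where
  L₁ L₀ : List (Vec Bool n)
  L₁ = solutions n (P ∘ (true ∷_))
  L₀ = solutions n (P ∘ (false ∷_))

#solutions-cong : ∀ n {P Q} → (∀ v → P v ≡ Q v) → #solutions n P ≡ #solutions n Q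
#solutions-cong zero {P} P≗Q rewrite P≗Q [] = refl
#solutions-cong (suc n) {P} {Q} P≗Q = begin
  #solutions (suc n) P                                          ≡⟨ #solutions-suc n P ⟩
  #solutions n (P ∘ (true ∷_)) + #solutions n (P ∘ (false ∷_))
    ≡⟨ cong₂ _+_ (#solutions-cong n (P≗Q ∘ (true ∷_))) (#solutions-cong n (P≗Q ∘ (false ∷_))) ⟩
  #solutions n (Q ∘ (true ∷_)) + #solutions n (Q ∘ (false ∷_))  ≡⟨ #solutions-suc n Q ⟨
  #solutions (suc n) Q                                          ∎

#solutions-false : ∀ n → #solutions n (λ _ → false) ≡ 0
#solutions-false zero    = refl
#solutions-false (suc n) =
  trans (#solutions-suc n (λ _ → false)) (cong₂ _+_ (#solutions-false n) (#solutions-false n))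

#solutions-guard : ∀ n β (P Q : Vec Bool n → Bool) →
  #solutions n (λ v → (β ∧ P v) ∧ Q v) ≡ (if β then #solutions n (λ v → P v ∧ Q v) else 0)
#solutions-guard n true  P Q = refl
#solutions-guard n false P Q = #solutions-false n

#solutions-positive : ∀ n P {v} → v List.∈ solutions n P → 0 < #solutions n P
#solutions-positive n P v∈ with solutions n P
... | _ ∷ _ = s≤s z≤n

-- Independent domination as a local condition on the cycle

window : Bool → Bool → Bool → Bool
window x y z = not (x ∧ y) ∧ (x ∨ y ∨ z)

window⇒independent : ∀ x y z → T (window x y z) → ¬ (T x × T y)
window⇒independent true  true  z ()
window⇒independent false y     z _ (() , _)
window⇒independent true  false z _ (_ , ())

window⇒dominated : ∀ x y z → T (window x y z) → T x ⊎ T y ⊎ T z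
window⇒dominated true  y     z     _ = inj₁ _
window⇒dominated false true  z     _ = inj₂ (inj₁ _)
window⇒dominated false false true  _ = inj₂ (inj₂ _)

window-intro : ∀ x y z → ¬ (T x × T y) → T x ⊎ T y ⊎ T z → T (window x y z)
window-intro true  true  z     ¬xy _ = ¬xy (_ , _)
window-intro true  false z     _   _ = _
window-intro false true  z     _   _ = _
window-intro false false true  _   _ = _
window-intro false false false _   (inj₁ ())
window-intro false false false _   (inj₂ (inj₁ ()))
window-intro false false false _   (inj₂ (inj₂ ()))

Succ-functional : ∀ {i j k : Fin n} → Succ n i j → Succ n i k → j ≡ k
Succ-functional         (inj₁ j≡)          (inj₁ k≡)          = toℕ-injective (trans j≡ (sym k≡))
Succ-functional         (inj₂ (_ , j≡0))   (inj₂ (_ , k≡0))   = toℕ-injective (trans j≡0 (sym k≡0))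
Succ-functional {j = j} (inj₁ j≡)          (inj₂ (i+1≡n , _)) = ⊥-elim (<-irrefl (trans j≡ i+1≡n) (toℕ<n j))
Succ-functional {k = k} (inj₂ (i+1≡n , _)) (inj₁ k≡)          = ⊥-elim (<-irrefl (trans k≡ i+1≡n) (toℕ<n k))

Succ-injective : ∀ {i j k : Fin n} → Succ n i k → Succ n j k → i ≡ j
Succ-injective (inj₁ k≡)           (inj₁ k≡′)         = toℕ-injective (suc-injective (trans (sym k≡) k≡′))
Succ-injective (inj₂ (i+1≡n , _)) (inj₂ (j+1≡n , _)) = toℕ-injective (suc-injective (trans i+1≡n (sym j+1≡n)))
Succ-injective (inj₁ k≡)           (inj₂ (_ , k≡0))   = ⊥-elim (0≢1+n (trans (sym k≡0) k≡))
Succ-injective (inj₂ (_ , k≡0))   (inj₁ k≡)          = ⊥-elim (0≢1+n (trans (sym k≡0) k≡))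

succ-exists : (i : Fin n) → ∃ (Succ n i)
succ-exists {suc n} i with m≤n⇒m<n∨m≡n (toℕ<n i)
... | inj₁ i+1<n = fromℕ< i+1<n , inj₁ (toℕ-fromℕ< i+1<n)
... | inj₂ i+1≡n = Fin.zero , inj₂ (i+1≡n , refl)

pred-exists : (j : Fin n) → ∃ λ i → Succ n i j
pred-exists {suc n} Fin.zero    = fromℕ n , inj₂ (cong suc (toℕ-fromℕ n) , refl)
pred-exists         (Fin.suc j) = inject₁ j , inj₁ (cong suc (sym (toℕ-inject₁ j)))

∈⇒T : ∀ {S : Subset n} {u} → u ∈ S → T (lookup S u)
∈⇒T u∈S = from T-≡ ([]=⇒lookup u∈S)

T⇒∈ : ∀ (S : Subset n) u → T (lookup S u) → u ∈ S
T⇒∈ S u t = lookup⇒[]= u S (to T-≡ t)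

LocallyValid : (n : ℕ) → Subset n → Set
LocallyValid n S =
  ∀ {p c s} → Succ n p c → Succ n c s → T (window (lookup S p) (lookup S c) (lookup S s))

IndepDom⇒LocallyValid : ∀ {n} (S : Subset n) → IndepDom n S → LocallyValid n S
IndepDom⇒LocallyValid {n} S (indep , dom) {p} {c} {s} pc cs =
  window-intro (lookup S p) (lookup S c) (lookup S s)
    (λ (tp , tc) → indep p c (T⇒∈ S p tp) (T⇒∈ S c tc) (inj₁ pc))
    (dominator-in-window (dom c))
  where
  dominator-in-window : c ∈ S ⊎ (∃ λ u → u ∈ S × Adj n u c) →
                        T (lookup S p) ⊎ T (lookup S c) ⊎ T (lookup S s)
  dominator-in-window (inj₁ c∈S) = inj₂ (inj₁ (∈⇒T c∈S))
  dominator-in-window (inj₂ (u , u∈S , inj₁ uc)) =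
    inj₁ (subst (T ∘ lookup S) (Succ-injective uc pc) (∈⇒T u∈S))
  dominator-in-window (inj₂ (u , u∈S , inj₂ cu)) =
    inj₂ (inj₂ (subst (T ∘ lookup S) (Succ-functional cu cs) (∈⇒T u∈S)))

LocallyValid⇒IndepDom : ∀ {n} (S : Subset n) → LocallyValid n S → IndepDom n S
LocallyValid⇒IndepDom {n} S locally = independent , dominating
  where
  independent : Independent n S
  independent u v u∈S v∈S (inj₁ uv) =
    window⇒independent _ _ _ (locally uv (proj₂ (succ-exists v))) (∈⇒T u∈S , ∈⇒T v∈S)
  independent u v u∈S v∈S (inj₂ vu) =
    window⇒independent _ _ _ (locally vu (proj₂ (succ-exists u))) (∈⇒T v∈S , ∈⇒T u∈S)

  dominating : Dominating n S
  dominating c with pred-exists c | succ-exists c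
  ... | p , pc | s , cs with window⇒dominated _ _ _ (locally pc cs)
  ...   | inj₁ tp        = inj₂ (p , T⇒∈ S p tp , inj₁ pc)
  ...   | inj₂ (inj₁ tc) = inj₁ (T⇒∈ S c tc)
  ...   | inj₂ (inj₂ ts) = inj₂ (s , T⇒∈ S s ts , inj₂ cs)

-- Scanning a cycle as a linear word

nth : Vec Bool n → ℕ → Bool
nth []       _       = false
nth (x ∷ xs) zero    = x
nth (x ∷ xs) (suc i) = nth xs i

nth-++ˡ : ∀ {k} (xs : Vec Bool n) (ys : Vec Bool k) i → nth (xs ++ᵛ ys) (toℕ i) ≡ lookup xs i
nth-++ˡ (x ∷ xs) ys Fin.zero    = refl
nth-++ˡ (x ∷ xs) ys (Fin.suc i) = nth-++ˡ xs ys i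

nth-++ʳ : ∀ {k} (xs : Vec Bool n) (ys : Vec Bool k) d → nth (xs ++ᵛ ys) (d + n) ≡ nth ys d
nth-++ʳ         []       ys d = cong (nth ys) (+-identityʳ d)
nth-++ʳ {suc n} (x ∷ xs) ys d rewrite +-suc d n = nth-++ʳ xs ys d

windowAt : Vec Bool n → ℕ → Bool
windowAt W i = window (nth W i) (nth W (suc i)) (nth W (suc (suc i)))

Windows : Vec Bool n → ℕ → Set
Windows W k = ∀ i → i < k → T (windowAt W i)

-- The conjunction of all windows of the word  p q xs a b.
scan : (a b p q : Bool) → Vec Bool m → Bool
scan a b p q []       = window p q a ∧ window q a b
scan a b p q (x ∷ xs) = window p q x ∧ scan a b q x xs

scan⇒Windows : ∀ a b p q (xs : Vec Bool m) → T (scan a b p q xs) →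
               Windows (p ∷ q ∷ xs ++ᵛ a ∷ b ∷ []) (2 + m)
scan⇒Windows a b p q []       h zero          _ = proj₁ (to (T-∧ {window p q a}) h)
scan⇒Windows a b p q []       h (suc zero)    _ = proj₂ (to (T-∧ {window p q a}) h)
scan⇒Windows a b p q []       h (suc (suc i)) (s≤s (s≤s ()))
scan⇒Windows a b p q (x ∷ xs) h zero          _ = proj₁ (to (T-∧ {window p q x}) h)
scan⇒Windows a b p q (x ∷ xs) h (suc i) (s≤s i<) =
  scan⇒Windows a b q x xs (proj₂ (to (T-∧ {window p q x}) h)) i i<

Windows⇒scan : ∀ a b p q (xs : Vec Bool m) → Windows (p ∷ q ∷ xs ++ᵛ a ∷ b ∷ []) (2 + m) →
               T (scan a b p q xs)
Windows⇒scan a b p q []       w = from T-∧ (w 0 (s≤s z≤n) , w 1 (s≤s (s≤s z≤n)))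
Windows⇒scan a b p q (x ∷ xs) w =
  from T-∧ (w 0 (s≤s z≤n) , Windows⇒scan a b q x xs (λ i i< → w (suc i) (s≤s i<)))

valid : Vec Bool (2 + m) → Bool
valid (a ∷ b ∷ xs) = scan a b a b xs

unroll : Vec Bool (2 + m) → Vec Bool (2 + m + 2)
unroll (a ∷ b ∷ xs) = (a ∷ b ∷ xs) ++ᵛ (a ∷ b ∷ [])

unroll-lookup : (S : Vec Bool (2 + m)) (i : Fin (2 + m)) → nth (unroll S) (toℕ i) ≡ lookup S i
unroll-lookup (a ∷ b ∷ xs) = nth-++ˡ (a ∷ b ∷ xs) (a ∷ b ∷ [])

unroll-periodic : (S : Vec Bool (2 + m)) → ∀ d → d < 2 →
                  nth (unroll S) (d + (2 + m)) ≡ nth (unroll S) (d + 0)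
unroll-periodic (a ∷ b ∷ xs) 0 _ = nth-++ʳ (a ∷ b ∷ xs) (a ∷ b ∷ []) 0
unroll-periodic (a ∷ b ∷ xs) 1 _ = nth-++ʳ (a ∷ b ∷ xs) (a ∷ b ∷ []) 1
unroll-periodic (a ∷ b ∷ xs) (suc (suc d)) (s≤s (s≤s ()))

unroll-Succ : (S : Vec Bool (2 + m)) {i j : Fin (2 + m)} → Succ (2 + m) i j →
  ∀ d → d < 2 → nth (unroll S) (d + suc (toℕ i)) ≡ nth (unroll S) (d + toℕ j)
unroll-Succ S (inj₁ j≡) d _ = cong (λ t → nth (unroll S) (d + t)) (sym j≡)
unroll-Succ S (inj₂ (i+1≡n , j≡0)) d d<2 = begin
  nth (unroll S) (d + suc _)  ≡⟨ cong (λ t → nth (unroll S) (d + t)) i+1≡n ⟩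
  nth (unroll S) (d + (2 + _)) ≡⟨ unroll-periodic S d d<2 ⟩
  nth (unroll S) (d + 0)       ≡⟨ cong (λ t → nth (unroll S) (d + t)) (sym j≡0) ⟩
  nth (unroll S) (d + toℕ _)   ∎

unroll-window : (S : Vec Bool (2 + m)) {p c s : Fin (2 + m)} → Succ (2 + m) p c → Succ (2 + m) c s →
                windowAt (unroll S) (toℕ p) ≡ window (lookup S p) (lookup S c) (lookup S s)
unroll-window S {p} {c} {s} pc cs
  rewrite unroll-Succ S pc 1 (s≤s (s≤s z≤n)) | unroll-Succ S cs 0 (s≤s z≤n)
        | unroll-Succ S pc 0 (s≤s z≤n)
        | unroll-lookup S p | unroll-lookup S c | unroll-lookup S s = refl

valid⇒LocallyValid : (S : Vec Bool (2 + m)) → T (valid S) → LocallyValid (2 + m) S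
valid⇒LocallyValid (a ∷ b ∷ xs) h {p} pc cs =
  subst T (unroll-window (a ∷ b ∷ xs) pc cs) (scan⇒Windows a b a b xs h (toℕ p) (toℕ<n p))

LocallyValid⇒valid : (S : Vec Bool (2 + m)) → LocallyValid (2 + m) S → T (valid S)
LocallyValid⇒valid {m} (a ∷ b ∷ xs) locally = Windows⇒scan a b a b xs windows
  where
  W : Vec Bool (2 + m + 2)
  W = unroll (a ∷ b ∷ xs)

  window-from : ∀ (p : Fin (2 + m)) → T (windowAt W (toℕ p))
  window-from p with succ-exists p
  ... | c , pc with succ-exists c
  ...   | s , cs = subst T (sym (unroll-window (a ∷ b ∷ xs) pc cs)) (locally pc cs)

  windows : Windows W (2 + m)
  windows i i<n = subst (T ∘ windowAt W) (toℕ-fromℕ< i<n) (window-from (fromℕ< i<n))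

valid⇒IndepDom : (S : Vec Bool (2 + m)) → T (valid S) → IndepDom (2 + m) S
valid⇒IndepDom S = LocallyValid⇒IndepDom S ∘ valid⇒LocallyValid S

IndepDom⇒valid : (S : Vec Bool (2 + m)) → IndepDom (2 + m) S → T (valid S)
IndepDom⇒valid S = LocallyValid⇒valid S ∘ IndepDom⇒LocallyValid S

hasSize : ℕ → Vec Bool n → Bool
hasSize r S = ∣ S ∣ ≡ᵇ r

scanCount : (a b p q : Bool) → ℕ → ℕ → ℕ
scanCount a b p q zero    zero    = if window p q a ∧ window q a b then 1 else 0
scanCount a b p q zero    (suc r) = 0
scanCount a b p q (suc m) zero    = if window p q false then scanCount a b q false m zero else 0
scanCount a b p q (suc m) (suc r) = (if window p q true  then scanCount a b q true  m r       else 0)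
                                  + (if window p q false then scanCount a b q false m (suc r) else 0)

#scan≡scanCount : ∀ a b p q m r →
  #solutions m (λ xs → scan a b p q xs ∧ hasSize r xs) ≡ scanCount a b p q m r
#scan≡scanCount a b p q zero zero with window p q a ∧ window q a b
... | true  = refl
... | false = refl
#scan≡scanCount a b p q zero (suc r) with window p q a ∧ window q a b
... | true  = refl
... | false = refl
#scan≡scanCount a b p q (suc m) zero = begin
  #solutions (suc m) (λ xs → scan a b p q xs ∧ hasSize 0 xs)
    ≡⟨ #solutions-suc m (λ xs → scan a b p q xs ∧ hasSize 0 xs) ⟩
  #solutions m (λ xs → (window p q true ∧ scan a b q true xs) ∧ false)
    + #solutions m (λ xs → (window p q false ∧ scan a b q false xs) ∧ hasSize 0 xs)
    ≡⟨ cong₂ _+_ (trans (#solutions-cong m (λ _ → ∧-zeroʳ _)) (#solutions-false m))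
                 (#solutions-guard m (window p q false) _ _) ⟩
  (if window p q false then #solutions m (λ xs → scan a b q false xs ∧ hasSize 0 xs) else 0)
    ≡⟨ cong (λ k → if window p q false then k else 0) (#scan≡scanCount a b q false m zero) ⟩
  scanCount a b p q (suc m) zero ∎
#scan≡scanCount a b p q (suc m) (suc r) = begin
  #solutions (suc m) (λ xs → scan a b p q xs ∧ hasSize (suc r) xs)
    ≡⟨ #solutions-suc m (λ xs → scan a b p q xs ∧ hasSize (suc r) xs) ⟩
  #solutions m (λ xs → (window p q true ∧ scan a b q true xs) ∧ hasSize r xs)
    + #solutions m (λ xs → (window p q false ∧ scan a b q false xs) ∧ hasSize (suc r) xs)
    ≡⟨ cong₂ _+_ (#solutions-guard m (window p q true) _ _)
                 (#solutions-guard m (window p q false) _ _) ⟩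
  (if window p q true  then #solutions m (λ xs → scan a b q true xs ∧ hasSize r xs) else 0)
    + (if window p q false then #solutions m (λ xs → scan a b q false xs ∧ hasSize (suc r) xs) else 0)
    ≡⟨ cong₂ _+_ (cong (λ k → if window p q true  then k else 0) (#scan≡scanCount a b q true  m r))
                 (cong (λ k → if window p q false then k else 0) (#scan≡scanCount a b q false m (suc r))) ⟩
  scanCount a b p q (suc m) (suc r) ∎

scanCount-11 : ∀ a b m r → scanCount a b true true m r ≡ 0
scanCount-11 a b zero    zero    = refl
scanCount-11 a b zero    (suc r) = refl
scanCount-11 a b (suc m) zero    = refl
scanCount-11 a b (suc m) (suc r) = refl

-- Scans of what follows a one preceded by a zero.
gapCount : Bool → Bool → ℕ → ℕ → ℕ
gapCount a b = scanCount a b false true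

gapCount-suc : ∀ a b m r → gapCount a b (suc m) r ≡ scanCount a b true false m r
gapCount-suc a b m zero    = refl
gapCount-suc a b m (suc r) rewrite scanCount-11 a b m r = refl

gapCount-1 : ∀ a b r → gapCount a b 1 (suc r) ≡ 0
gapCount-1 a b r = gapCount-suc a b 0 (suc r)

gapCount-2 : ∀ a b r → gapCount a b 2 (suc r) ≡ gapCount a b 0 r
gapCount-2 a b r = trans (gapCount-suc a b 1 (suc r)) (+-identityʳ _)

gapCount-step : ∀ a b x r → gapCount a b (3 + x) (suc r) ≡ gapCount a b x r + gapCount a b (suc x) r
gapCount-step a b x r = begin
  gapCount a b (3 + x) (suc r)                    ≡⟨ gapCount-suc a b (2 + x) (suc r) ⟩
  gapCount a b (suc x) r + (gapCount a b x r + 0) ≡⟨ cong (gapCount a b (suc x) r +_) (+-identityʳ _) ⟩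
  gapCount a b (suc x) r + gapCount a b x r       ≡⟨ +-comm (gapCount a b (suc x) r) _ ⟩
  gapCount a b x r + gapCount a b (suc x) r       ∎

-- Arrays obeying the gap recurrence are binomial coefficients

module GapRecurrence
  (A : ℕ → ℕ → ℕ)
  (A-step : ∀ x r → A (3 + x) (suc r) ≡ A x r + A (suc x) r)
  (A-0 : ∀ r → A 0 (suc r) ≡ 0)
  (A-1 : ∀ r → A 1 (suc r) ≡ 0)
  (A-2 : ∀ r → A 2 (suc r) ≡ A 0 r)
  (e f : ℕ)
  (row₀ : ∀ i → A (f + i) 0 ≡ e C i)
  (row₀-short : ∀ x → x < f → A x 0 ≡ 0)
  (row₁ : A (2 + f) 1 ≡ 1)
  where

  private
    double-suc : ∀ r → suc r + suc r + f ≡ 2 + (r + r + f)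
    double-suc r = cong (λ t → suc t + f) (+-suc r r)

  vanishes-short : ∀ r x → x < r + r + f → A x r ≡ 0
  vanishes-short zero          x             x<f = row₀-short x x<f
  vanishes-short (suc r)       0             _   = A-0 r
  vanishes-short (suc r)       1             _   = A-1 r
  vanishes-short (suc zero)    2             2<  = trans (A-2 0) (row₀-short 0 (≤-pred (≤-pred 2<)))
  vanishes-short (suc (suc r)) 2             _   = trans (A-2 (suc r)) (A-0 r)
  vanishes-short (suc r)       (suc (suc (suc x))) x< = begin
    A (3 + x) (suc r)          ≡⟨ A-step x r ⟩
    A x r + A (suc x) r        ≡⟨ cong₂ _+_ (vanishes-short r x (<-trans (n<1+n x) x+1<))
                                            (vanishes-short r (suc x) x+1<) ⟩
    0                          ∎
    where
    x+1< : suc x < r + r + f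
    x+1< = ≤-pred (≤-pred (subst (3 + x <_) (double-suc r) x<))

  closed-form : ∀ r i → A (r + r + f + i) r ≡ (r + e) C i
  closed-form zero          i       = row₀ i
  closed-form (suc r)       (suc i) = begin
    A (suc r + suc r + f + suc i) (suc r)            ≡⟨ cong (λ t → A t (suc r)) index ⟩
    A (3 + (r + r + f + i)) (suc r)                  ≡⟨ A-step (r + r + f + i) r ⟩
    A (r + r + f + i) r + A (suc (r + r + f + i)) r  ≡⟨ cong (A (r + r + f + i) r +_) index′ ⟩
    A (r + r + f + i) r + A (r + r + f + suc i) r    ≡⟨ cong₂ _+_ (closed-form r i) (closed-form r (suc i)) ⟩
    (r + e) C i + (r + e) C suc i                    ≡⟨ nCk+nC[k+1]≡[n+1]C[k+1] (r + e) i ⟩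
    suc (r + e) C suc i                              ∎
    where
    index : suc r + suc r + f + suc i ≡ 3 + (r + r + f + i)
    index = trans (cong (_+ suc i) (double-suc r)) (cong (2 +_) (+-suc (r + r + f) i))
    index′ : A (suc (r + r + f + i)) r ≡ A (r + r + f + suc i) r
    index′ = cong (λ t → A t r) (sym (+-suc (r + r + f) i))
  closed-form (suc zero)    zero    = trans (cong (λ t → A t 1) (+-identityʳ (2 + f))) row₁
  closed-form (suc (suc r)) zero    = begin
    A (suc (suc r) + suc (suc r) + f + 0) (2 + r)              ≡⟨ cong (λ t → A t (2 + r)) index ⟩
    A (3 + suc (r + r + f)) (2 + r)                            ≡⟨ A-step (suc (r + r + f)) (suc r) ⟩
    A (suc (r + r + f)) (suc r) + A (2 + (r + r + f)) (suc r)  ≡⟨ cong₂ _+_ too-short index′ ⟩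
    0 + A (suc r + suc r + f + 0) (suc r)                      ≡⟨ closed-form (suc r) zero ⟩
    1                                                          ∎
    where
    index : suc (suc r) + suc (suc r) + f + 0 ≡ 3 + suc (r + r + f)
    index = trans (+-identityʳ _) (trans (double-suc (suc r)) (cong (2 +_) (double-suc r)))
    index′ : A (2 + (r + r + f)) (suc r) ≡ A (suc r + suc r + f + 0) (suc r)
    index′ = cong (λ t → A t (suc r)) (sym (trans (+-identityʳ _) (double-suc r)))
    too-short : A (suc (r + r + f)) (suc r) ≡ 0
    too-short = vanishes-short (suc r) _ (subst (suc (r + r + f) <_) (sym (double-suc r)) (n<1+n _))

module GapCount (a b : Bool) =
  GapRecurrence (gapCount a b) (gapCount-step a b) (λ _ → refl) (gapCount-1 a b) (gapCount-2 a b)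

gapCount-10 : ∀ r i → gapCount true false (r + r + 1 + i) r ≡ (r + 1) C i
gapCount-10 = GapCount.closed-form true false 1 1 row₀ short refl
  where
  row₀ : ∀ i → gapCount true false (1 + i) 0 ≡ 1 C i
  row₀ 0               = refl
  row₀ 1               = refl
  row₀ (suc (suc i))   = sym (k>n⇒nCk≡0 {1} {2 + i} (s≤s (s≤s z≤n)))
  short : ∀ x → x < 1 → gapCount true false x 0 ≡ 0
  short 0       _            = refl
  short (suc x) (s≤s ())

gapCount-01 : ∀ r i → gapCount false true (r + r + 0 + i) r ≡ (r + 1) C i
gapCount-01 = GapCount.closed-form false true 1 0 row₀ (λ _ ()) refl
  where
  row₀ : ∀ i → gapCount false true i 0 ≡ 1 C i
  row₀ 0                   = refl
  row₀ 1                   = refl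
  row₀ 2                   = refl
  row₀ (suc (suc (suc i))) = sym (k>n⇒nCk≡0 {1} {3 + i} (s≤s (s≤s z≤n)))

gapCount-00 : ∀ r i → gapCount false false (r + r + 0 + i) r ≡ (r + 0) C i
gapCount-00 = GapCount.closed-form false false 0 0 row₀ (λ _ ()) refl
  where
  row₀ : ∀ i → gapCount false false i 0 ≡ 0 C i
  row₀ 0                   = refl
  row₀ 1                   = refl
  row₀ 2                   = refl
  row₀ (suc (suc (suc i))) = refl

validOfSize : ℕ → Vec Bool (2 + m) → Bool
validOfSize r S = valid S ∧ hasSize r S

#valid-split : ∀ m c → #solutions (3 + m) (validOfSize (suc c))
  ≡ gapCount true false (2 + m) c + gapCount false true (1 + m) c + gapCount false false m c
#valid-split m c = begin
  #solutions (3 + m) P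
    ≡⟨ #solutions-suc (2 + m) P ⟩
  #solutions (2 + m) (P ∘ (true ∷_)) + #solutions (2 + m) (P ∘ (false ∷_))
    ≡⟨ cong₂ _+_ (#solutions-suc (1 + m) (P ∘ (true ∷_))) (#solutions-suc (1 + m) (P ∘ (false ∷_))) ⟩
  (#solutions (1 + m) (P ∘ (true ∷_) ∘ (true ∷_)) + #solutions (1 + m) (P ∘ (true ∷_) ∘ (false ∷_)))
    + (#solutions (1 + m) (P ∘ (false ∷_) ∘ (true ∷_)) + #solutions (1 + m) (P ∘ (false ∷_) ∘ (false ∷_)))
    ≡⟨ cong₂ _+_ (cong₂ _+_ starts-11 starts-10) (cong₂ _+_ starts-01 starts-00) ⟩
  g₁₀ + (g₀₁ + g₀₀)
    ≡⟨ +-assoc g₁₀ g₀₁ g₀₀ ⟨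
  g₁₀ + g₀₁ + g₀₀ ∎
  where
  P : Vec Bool (3 + m) → Bool
  P = validOfSize (suc c)
  g₁₀ g₀₁ g₀₀ : ℕ
  g₁₀ = gapCount true false (2 + m) c
  g₀₁ = gapCount false true (1 + m) c
  g₀₀ = gapCount false false m c
  starts-11 : #solutions (1 + m) (P ∘ (true ∷_) ∘ (true ∷_)) ≡ 0
  starts-11 = trans (#solutions-suc m (P ∘ (true ∷_) ∘ (true ∷_)))
                    (cong₂ _+_ (#solutions-false m) (#solutions-false m))
  starts-10 : #solutions (1 + m) (P ∘ (true ∷_) ∘ (false ∷_)) ≡ g₁₀
  starts-10 = trans (#scan≡scanCount true false true false (1 + m) c) (sym (gapCount-suc true false (1 + m) c))
  starts-01 : #solutions (1 + m) (P ∘ (false ∷_) ∘ (true ∷_)) ≡ g₀₁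
  starts-01 = #scan≡scanCount false true false true (1 + m) c
  starts-00 : #solutions (1 + m) (P ∘ (false ∷_) ∘ (false ∷_)) ≡ g₀₀
  starts-00 = trans (#scan≡scanCount false false false false (1 + m) (suc c)) (+-identityʳ _)

#valid-closed-form : ∀ c d → #solutions (3 + (c + c + d)) (validOfSize (suc c))
  ≡ suc c C suc d + suc c C suc d + c C d
#valid-closed-form c d = trans (#valid-split (c + c + d) c) (cong₂ _+_ (cong₂ _+_ g₁₀ g₀₁) g₀₀)
  where
  at : ∀ a b {x y} → x ≡ y → gapCount a b x c ≡ gapCount a b y c
  at a b = cong (λ t → gapCount a b t c)
  index₁₀ : ∀ c d → 2 + (c + c + d) ≡ c + c + 1 + suc d
  index₁₀ = solve-∀
  index₀₁ : ∀ c d → 1 + (c + c + d) ≡ c + c + 0 + suc d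
  index₀₁ = solve-∀
  index₀₀ : ∀ c d → c + c + d ≡ c + c + 0 + d
  index₀₀ = solve-∀
  g₁₀ : gapCount true false (2 + (c + c + d)) c ≡ suc c C suc d
  g₁₀ = trans (at true false (index₁₀ c d)) (trans (gapCount-10 c (suc d)) (cong (_C suc d) (+-comm c 1)))
  g₀₁ : gapCount false true (1 + (c + c + d)) c ≡ suc c C suc d
  g₀₁ = trans (at false true (index₀₁ c d)) (trans (gapCount-01 c (suc d)) (cong (_C suc d) (+-comm c 1)))
  g₀₀ : gapCount false false (c + c + d) c ≡ c C d
  g₀₀ = trans (at false false (index₀₀ c d)) (trans (gapCount-00 c d) (cong (_C d) (+-identityʳ c)))

#valid-vanishes : ∀ m c → 3 * c < m → #solutions (3 + m) (validOfSize (suc c)) ≡ 0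
#valid-vanishes m c 3c<m = begin
  #solutions (3 + m) (validOfSize (suc c))
    ≡⟨ cong (λ t → #solutions (3 + t) (validOfSize (suc c))) m≡ ⟨
  #solutions (3 + (c + c + d)) (validOfSize (suc c))
    ≡⟨ #valid-closed-form c d ⟩
  suc c C suc d + suc c C suc d + c C d
    ≡⟨ cong₂ _+_ (cong₂ _+_ (k>n⇒nCk≡0 (s≤s c<d)) (k>n⇒nCk≡0 (s≤s c<d))) (k>n⇒nCk≡0 c<d) ⟩
  0 ∎
  where
  d : ℕ
  d = m ∸ (c + c)
  triple : ∀ c → 3 * c ≡ c + c + c
  triple = solve-∀
  2c≤m : c + c ≤ m
  2c≤m = ≤-trans (m≤m+n (c + c) c) (≤-trans (≤-reflexive (sym (triple c))) (<⇒≤ 3c<m))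
  m≡ : c + c + d ≡ m
  m≡ = m+[n∸m]≡n 2c≤m
  c<d : c < d
  c<d = +-cancelˡ-< (c + c) c d (subst₂ _<_ (triple c) (sym m≡) 3c<m)

x∈p⇒0<∣p∣ : ∀ {S : Subset n} {u} → u ∈ S → 0 < ∣ S ∣
x∈p⇒0<∣p∣             here       = s≤s z≤n
x∈p⇒0<∣p∣ {S = x ∷ S} (there u∈S) = <-≤-trans (x∈p⇒0<∣p∣ u∈S) (∣p∣≤∣x∷p∣ x S)

valid⇒n≤3∣S∣ : ∀ m (S : Vec Bool (3 + m)) → T (valid S) → 3 + m ≤ 3 * ∣ S ∣
valid⇒n≤3∣S∣ m S valid-S = bound ∣ S ∣ refl (nonempty (proj₂ (valid⇒IndepDom S valid-S) Fin.zero))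
  where
  nonempty : Fin.zero ∈ S ⊎ (∃ λ u → u ∈ S × Adj (3 + m) u Fin.zero) → 0 < ∣ S ∣
  nonempty (inj₁ 0∈S)          = x∈p⇒0<∣p∣ 0∈S
  nonempty (inj₂ (_ , u∈S , _)) = x∈p⇒0<∣p∣ u∈S

  -- Were 3∣S∣ < n, S would be one of the valid sets of its size, which #valid-vanishes says do not exist.
  bound : ∀ s → ∣ S ∣ ≡ s → 0 < s → 3 + m ≤ 3 * s
  bound (suc c) ∣S∣≡ _ with 3 + m ≤? 3 * suc c
  ... | yes 3+m≤ = 3+m≤
  ... | no  3+m≰ =
    ⊥-elim (<-irrefl (sym (#valid-vanishes m c 3c<m)) (#solutions-positive (3 + m) (validOfSize (suc c)) S∈))
    where
    3c<m : 3 * c < m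
    3c<m = +-cancelˡ-< 3 (3 * c) m (subst (_< 3 + m) (*-suc 3 c) (≰⇒> 3+m≰))
    S∈ : S List.∈ solutions (3 + m) (validOfSize (suc c))
    S∈ = solutions-complete (3 + m) (validOfSize (suc c)) S (from T-∧ (valid-S , ≡⇒≡ᵇ _ _ ∣S∣≡))

NumISets-from-count : ∀ {m} r N → #solutions (2 + m) (validOfSize r) ≡ N → 0 < N →
  (∀ S → T (valid S) → r ≤ ∣ S ∣) → NumISets (2 + m) N
NumISets-from-count {m} r N count≡N N>0 lower-bound =
  L , solutions-unique (2 + m) (validOfSize r) , (λ S → mk⇔ (ISet⇒∈ S) (∈⇒ISet S)) , count≡N
  where
  L : List (Vec Bool (2 + m))
  L = solutions (2 + m) (validOfSize r)

  sized : ∀ {S} → S List.∈ L → T (valid S) × ∣ S ∣ ≡ r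
  sized {S} S∈ with to (T-∧ {valid S}) (solutions-sound (2 + m) (validOfSize r) S∈)
  ... | valid-S , size-S = valid-S , ≡ᵇ⇒≡ ∣ S ∣ r size-S

  witness : ∀ (L′ : List (Vec Bool (2 + m))) → 0 < length L′ → ∃ λ W → W List.∈ L′
  witness (W ∷ _) _ = W , here refl

  W : Vec Bool (2 + m)
  W = proj₁ (witness L (subst (0 <_) (sym count≡N) N>0))
  W-sized : T (valid W) × ∣ W ∣ ≡ r
  W-sized = sized (proj₂ (witness L (subst (0 <_) (sym count≡N) N>0)))

  ISet⇒∈ : ∀ S → ISet (2 + m) S → S List.∈ L
  ISet⇒∈ S (S-indepDom , S-minimum) =
    solutions-complete (2 + m) (validOfSize r) S (from T-∧ (valid-S , ≡⇒≡ᵇ ∣ S ∣ r ∣S∣≡r))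
    where
    valid-S : T (valid S)
    valid-S = IndepDom⇒valid S S-indepDom
    ∣S∣≤r : ∣ S ∣ ≤ r
    ∣S∣≤r = subst (∣ S ∣ ≤_) (proj₂ W-sized) (S-minimum W (valid⇒IndepDom W (proj₁ W-sized)))
    ∣S∣≡r : ∣ S ∣ ≡ r
    ∣S∣≡r = ≤-antisym ∣S∣≤r (lower-bound S valid-S)

  ∈⇒ISet : ∀ S → S List.∈ L → ISet (2 + m) S
  ∈⇒ISet S S∈ =
    valid⇒IndepDom S (proj₁ (sized S∈)) ,
    λ U U-indepDom → subst (_≤ ∣ U ∣) (sym (proj₂ (sized S∈))) (lower-bound U (IndepDom⇒valid U U-indepDom))

-- For n = 3 + m and k ≤ 2 the hypothesis says r = ⌈n/3⌉.
minimum-size : ∀ m r k → k ≤ 2 → 3 * r ≡ k + (3 + m) → ∀ S → T (valid S) → r ≤ ∣ S ∣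
minimum-size m r k k≤2 3r≡ S valid-S = ≤-pred (*-cancelˡ-< 3 r (suc ∣ S ∣) 3r<)
  where
  3r< : 3 * r < 3 * suc ∣ S ∣
  3r< = subst₂ _<_ (sym 3r≡) (sym (*-suc 3 ∣ S ∣)) (s≤s (+-mono-≤ k≤2 (valid⇒n≤3∣S∣ m S valid-S)))

[1+n]Cn≡1+n : ∀ n → suc n C n ≡ suc n
[1+n]Cn≡1+n zero    = refl
[1+n]Cn≡1+n (suc n) = begin
  suc (suc n) C suc n         ≡⟨ nCk+nC[k+1]≡[n+1]C[k+1] (suc n) n ⟨
  suc n C n + suc n C suc n   ≡⟨ cong₂ _+_ ([1+n]Cn≡1+n n) (nCn≡1 (suc n)) ⟩
  suc n + 1                   ≡⟨ +-comm (suc n) 1 ⟩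
  suc (suc n)                 ∎

[2+n]Cn*2≡[2+n]*[1+n] : ∀ n → (suc (suc n) C n) * 2 ≡ suc (suc n) * suc n
[2+n]Cn*2≡[2+n]*[1+n] zero    = refl
[2+n]Cn*2≡[2+n]*[1+n] (suc n) = begin
  ((3 + n) C suc n) * 2                      ≡⟨ cong (_* 2) (nCk+nC[k+1]≡[n+1]C[k+1] (2 + n) n) ⟨
  ((2 + n) C n + (2 + n) C suc n) * 2        ≡⟨ *-distribʳ-+ 2 ((2 + n) C n) _ ⟩
  ((2 + n) C n) * 2 + ((2 + n) C suc n) * 2  ≡⟨ cong₂ _+_ ([2+n]Cn*2≡[2+n]*[1+n] n)
                                                           (cong (_* 2) ([1+n]Cn≡1+n (suc n))) ⟩
  (2 + n) * (1 + n) + (2 + n) * 2            ≡⟨ polynomial n ⟩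
  (3 + n) * (2 + n)                          ∎
  where
  polynomial : ∀ n → (2 + n) * (1 + n) + (2 + n) * 2 ≡ (3 + n) * (2 + n)
  polynomial = solve-∀

iSets-3k : ∀ j → NumISets (3 + (j + j + j)) 3
iSets-3k j =
  NumISets-from-count (suc j) 3 count (s≤s z≤n) (minimum-size (j + j + j) (suc j) 0 z≤n (three-r j))
  where
  count : #solutions (3 + (j + j + j)) (validOfSize (suc j)) ≡ 3
  count = trans (#valid-closed-form j j)
                (cong₂ _+_ (cong₂ _+_ (nCn≡1 (suc j)) (nCn≡1 (suc j))) (nCn≡1 j))
  three-r : ∀ j → 3 * suc j ≡ 0 + (3 + (j + j + j))
  three-r = solve-∀

binomial-sum-3k+1 : ∀ j → ((3 + j) C suc j + (3 + j) C suc j + (2 + j) C j) * 2 ≡ (2 + j) * (3 * (2 + j) + 1)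
binomial-sum-3k+1 j = begin
  ((3 + j) C suc j + (3 + j) C suc j + (2 + j) C j) * 2
    ≡⟨ distribute ((3 + j) C suc j) ((2 + j) C j) ⟩
  ((3 + j) C suc j) * 2 + ((3 + j) C suc j) * 2 + ((2 + j) C j) * 2
    ≡⟨ cong₂ _+_ (cong₂ _+_ ([2+n]Cn*2≡[2+n]*[1+n] (suc j)) ([2+n]Cn*2≡[2+n]*[1+n] (suc j)))
                 ([2+n]Cn*2≡[2+n]*[1+n] j) ⟩
  (3 + j) * (2 + j) + (3 + j) * (2 + j) + (2 + j) * (1 + j)
    ≡⟨ polynomial j ⟩
  (2 + j) * (3 * (2 + j) + 1) ∎
  where
  distribute : ∀ x y → (x + x + y) * 2 ≡ x * 2 + x * 2 + y * 2
  distribute = solve-∀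
  polynomial : ∀ j → (3 + j) * (2 + j) + (3 + j) * (2 + j) + (2 + j) * (1 + j) ≡ (2 + j) * (3 * (2 + j) + 1)
  polynomial = solve-∀

iSets-3k+1 : ∀ j → NumISets (3 + (suc (suc j) + suc (suc j) + j)) (((2 + j) * (3 * (2 + j) + 1)) / 2)
iSets-3k+1 j = NumISets-from-count (3 + j) _ count (subst (0 <_) Y≡ Y>0)
                 (minimum-size (suc (suc j) + suc (suc j) + j) (3 + j) 2 ≤-refl (three-r j))
  where
  Y : ℕ
  Y = (3 + j) C suc j + (3 + j) C suc j + (2 + j) C j
  Y≡ : Y ≡ ((2 + j) * (3 * (2 + j) + 1)) / 2
  Y≡ = trans (sym (m*n/n≡m Y 2)) (cong (_/ 2) (binomial-sum-3k+1 j))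
  Y>0 : 0 < Y
  Y>0 = *-cancelʳ-< 2 0 Y (subst (0 <_) (sym (binomial-sum-3k+1 j)) (s≤s z≤n))
  count : #solutions (3 + (suc (suc j) + suc (suc j) + j)) (validOfSize (3 + j)) ≡ ((2 + j) * (3 * (2 + j) + 1)) / 2
  count = trans (#valid-closed-form (suc (suc j)) j) Y≡
  three-r : ∀ j → 3 * (3 + j) ≡ 2 + (3 + (suc (suc j) + suc (suc j) + j))
  three-r = solve-∀

iSets-3k+2 : ∀ j → NumISets (3 + (suc j + suc j + j)) (3 + (suc j + suc j + j))
iSets-3k+2 j = NumISets-from-count (2 + j) _ count (s≤s z≤n)
                 (minimum-size (suc j + suc j + j) (2 + j) 1 (s≤s z≤n) (three-r j))
  where
  count : #solutions (3 + (suc j + suc j + j)) (validOfSize (2 + j)) ≡ 3 + (suc j + suc j + j)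
  count = begin
    #solutions (3 + (suc j + suc j + j)) (validOfSize (2 + j))
      ≡⟨ #valid-closed-form (suc j) j ⟩
    (2 + j) C suc j + (2 + j) C suc j + suc j C j
      ≡⟨ cong₂ _+_ (cong₂ _+_ ([1+n]Cn≡1+n (suc j)) ([1+n]Cn≡1+n (suc j))) ([1+n]Cn≡1+n j) ⟩
    (2 + j) + (2 + j) + (1 + j)
      ≡⟨ arithmetic j ⟩
    3 + (suc j + suc j + j) ∎
    where
    arithmetic : ∀ j → (2 + j) + (2 + j) + (1 + j) ≡ 3 + (suc j + suc j + j)
    arithmetic = solve-∀
  three-r : ∀ j → 3 * (2 + j) ≡ 1 + (3 + (suc j + suc j + j))
  three-r = solve-∀

iSets-4 : NumISets 4 2
iSets-4 = NumISets-from-count 2 2 refl (s≤s z≤n) (minimum-size 1 2 2 ≤-refl refl)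

iSets-mod0 : ∀ n k → 3 ≤ n → n ≡ 3 * k → NumISets n 3
iSets-mod0 _ zero    () refl
iSets-mod0 _ (suc j) _  refl = subst (λ n → NumISets n 3) (n≡ j) (iSets-3k j)
  where
  n≡ : ∀ j → 3 + (j + j + j) ≡ 3 * suc j
  n≡ = solve-∀

iSets-mod1 : ∀ n k → 3 ≤ n → n ≡ 3 * k + 1 → NumISets n ((k * (3 * k + 1)) / 2)
iSets-mod1 _ zero          (s≤s ()) refl
iSets-mod1 _ (suc zero)    _        refl = iSets-4
iSets-mod1 _ (suc (suc j)) _        refl =
  subst (λ n → NumISets n (((2 + j) * (3 * (2 + j) + 1)) / 2)) (n≡ j) (iSets-3k+1 j)
  where
  n≡ : ∀ j → 3 + (suc (suc j) + suc (suc j) + j) ≡ 3 * suc (suc j) + 1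
  n≡ = solve-∀

iSets-mod2 : ∀ n k → 3 ≤ n → n ≡ 3 * k + 2 → NumISets n n
iSets-mod2 _ zero    (s≤s (s≤s ())) refl
iSets-mod2 _ (suc j) _              refl = subst (λ n → NumISets n n) (n≡ j) (iSets-3k+2 j)
  where
  n≡ : ∀ j → 3 + (suc j + suc j + j) ≡ 3 * suc j + 2
  n≡ = solve-∀

mainTheorem9 : ∀ (n k : ℕ) → 3 ≤ n →
    ((n ≡ 3 * k → NumISets n 3)
    × (n ≡ 3 * k + 1 → NumISets n ((k * (3 * k + 1)) / 2))
    × (n ≡ 3 * k + 2 → NumISets n n))
mainTheorem9 n k 3≤n = iSets-mod0 n k 3≤n , iSets-mod1 n k 3≤n , iSets-mod2 n k 3≤n
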